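{- Let $r\ge2$ and $s\ge2$ be integers, and let $H$ be an $r$-uniform hypergraph with $s(H)=s$. Then \[\gamma_{s,H}=\min\left\{\frac{\left|\left\{e\in E(H): \binom{e}{s-1}\cap\mathcal S\neq\emptyset\right\}\right|-1}{|\mathcal S|}\ :\ \emptyset\neq\mathcal S\subseteq\partial_{s-1}(H),\ |\partial_{s-1}(H)\setminus\mathcal S|\ge\binom{r}{s-1}\right\}.\]
   Context: An $r$-uniform hypergraph $H$ has finite vertex set $V(H)$ and edge set $E(H)\subseteq\binom{V(H)}{r}$, where $\binom{T}{k}$ is the set of $k$-subsets of $T$. The sparseness $s(H)$ of non-empty $H$ is the size of a smallest $S\subseteq V(H)$ contained in exactly one edge of $H$. For $m\ge1$, the $m$-shadow $\partial_m(G)$ is the set of $m$-element sets contained in some edge of $G$. Define \[\gamma_{s,H}=\min\left\{\frac{|E(H)|-|E(G)|-1}{|\partial_{s-1}(H)|-|\partial_{s-1}(G)|}: G\subseteq H,\ E(G)\neq\emptyset,\ |\partial_{s-1}(G)|<|\partial_{s-1}(H)|\right\},\] where $G\subseteq H$ means $E(G)\subseteq E(H)$. -}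

module Defs where

open import Data.Bool using (Bool; true; false; _∧_; not)
open import Data.Nat using (ℕ; zero; suc; _∸_; _<_; _≤_; >-nonZero)
open import Data.Nat.Combinatorics using (_C_)
open import Data.Integer using (ℤ; +_; _-_)
open import Data.Rational using (ℚ; _/_)
import Data.Rational as ℚ
open import Data.Fin using (Fin)
open import Data.Fin.Subset using (Subset; ∣_∣; _⊆_; inside; outside)
open import Data.Fin.Subset.Properties using (_⊆?_)
open import Data.Vec using (_∷_; [])
open import Data.List using (List; []; _∷_; map; _++_; filter; length)
open import Data.Bool.ListAction using (any)
open import Data.Product using (Σ; ∃; ∃-syntax; _×_; _,_)
open import Relation.Nullary using (¬_)
open import Relation.Nullary.Decidable using (⌊_⌋)
open import Relation.Binary.PropositionalEquality using (_≡_)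
open import Data.Nat.Properties using (_≟_)

-- A finite set of subsets of the vertex set Fin n, given by its
-- (Boolean) characteristic function on the finite type Subset n.
Family : ℕ → Set
Family n = Subset n → Bool

-- All subsets of Fin n (each exactly once).
allSubsets : (n : ℕ) → List (Subset n)
allSubsets zero    = [] ∷ []
allSubsets (suc n) = map (outside ∷_) (allSubsets n) ++ map (inside ∷_) (allSubsets n)

size : ∀ {n} → Family n → ℕ
size {n} F = length (filter (λ T → F T Data.Bool.≟ true) (allSubsets n))
  where import Data.Bool

_∈F_ : ∀ {n} → Subset n → Family n → Set
T ∈F F = F T ≡ true

record Hypergraph (r : ℕ) : Set where
  field
    n       : ℕ
    edges   : Family n
    uniform : ∀ e → e ∈F edges → ∣ e ∣ ≡ r
open Hypergraph public

-- G ⊆ H: same vertex set, E(G) ⊆ E(H).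
_⊆E_ : ∀ {n} → Family n → Family n → Set
G ⊆E H = ∀ e → e ∈F G → e ∈F H

degree : ∀ {n} → Family n → Subset n → ℕ
degree E S = size (λ e → E e ∧ ⌊ S ⊆? e ⌋)

HasSparseness : ∀ {r} → Hypergraph r → ℕ → Set
HasSparseness H s =
  (∃[ e ] e ∈F edges H)
  × (∃[ S ] (degree (edges H) S ≡ 1 × ∣ S ∣ ≡ s))
  × (∀ S → degree (edges H) S ≡ 1 → s ≤ ∣ S ∣)

shadow : ∀ {n} → ℕ → Family n → Family n
shadow {n} m E T = ⌊ ∣ T ∣ ≟ m ⌋ ∧ any (λ e → E e ∧ ⌊ T ⊆? e ⌋) (allSubsets n)

-- binom(e, m) ∩ S ≠ ∅, as a Boolean test.
hits : ∀ {n} → ℕ → Family n → Subset n → Bool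
hits {n} m S e = any (λ T → ⌊ ∣ T ∣ ≟ m ⌋ ∧ (⌊ T ⊆? e ⌋ ∧ S T)) (allSubsets n)

frac : ℤ → (d : ℕ) → 0 < d → ℚ
frac p d pos = _/_ p d {{>-nonZero pos}}

IsMin : (ℚ → Set) → ℚ → Set
IsMin P q = P q × (∀ q' → P q' → q ℚ.≤ q')

GammaSet : ∀ {r} → Hypergraph r → ℕ → ℚ → Set
GammaSet H s q =
  Σ (Family (n H)) λ G →
    G ⊆E edges H
    × (∃[ e ] e ∈F G)
    × Σ (size (shadow (s ∸ 1) G) < size (shadow (s ∸ 1) (edges H))) λ lt →
        q ≡ frac (+ size (edges H) - + size G - + 1)
                 (size (shadow (s ∸ 1) (edges H)) ∸ size (shadow (s ∸ 1) G))
                 (Data.Nat.Properties.m<n⇒0<n∸m lt)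
  where import Data.Nat.Properties

SSet : ∀ {r} → Hypergraph r → ℕ → ℚ → Set
SSet {r} H s q =
  Σ (Family (n H)) λ S →
    (∃[ T ] T ∈F S)
    × (∀ T → T ∈F S → T ∈F shadow (s ∸ 1) (edges H))
    × (r C (s ∸ 1) ≤ size (λ T → shadow (s ∸ 1) (edges H) T ∧ not (S T)))
    × Σ (0 < size S) λ pos →
        q ≡ frac (+ size (λ e → edges H e ∧ hits (s ∸ 1) S e) - + 1) (size S) pos

module Submission where

-- The two sets of ratios bound each other from below, hence have the same minimum.
-- A subhypergraph G with an edge e gives S = ∂H ∖ ∂G: it has the same denominator, no edge
-- of G meets it (so at most |E(H)| − |E(G)| edges do), and ∂H ∖ S = ∂G contains the
-- binom(r, s−1) sets of binom(e, s−1).  Conversely S gives G = the edges missing S, whose shadow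
-- avoids S; if every edge meets S, a single edge serves as G instead, and this is where
-- |∂H ∖ S| ≥ binom(r, s−1) is needed.

open import Defs
open import Data.Bool using (Bool; true; false; _∧_; not)
import Data.Bool as Bool
open import Data.Bool.ListAction using (any)
open import Data.Bool.Properties using (∧-conicalˡ; ∧-conicalʳ; ∧-zeroʳ; T-≡)
open import Data.Empty using (⊥-elim)
open import Data.Fin.Subset using (Subset; ∣_∣; inside; outside)
open import Data.Fin.Subset.Properties using (_⊆?_)
open import Data.Integer as ℤ using (+_; _-_; _*_; +≤+)
import Data.Integer.Properties as ℤ
open import Data.List using (List; []; _∷_; map; _++_; filter; length)
open import Data.List.Membership.Propositional using (_∈_)
open import Data.List.Membership.Propositional.Properties
  using (∈-map⁺; ∈-++⁺ˡ; ∈-++⁺ʳ; ∈-filter⁻)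
import Data.List.Properties as List
open import Data.List.Relation.Binary.Sublist.Propositional using (⊆-refl)
open import Data.List.Relation.Binary.Sublist.Propositional.Properties
  using (filter⁺; length-mono-≤)
open import Data.List.Relation.Unary.Any using (here; satisfied)
import Data.List.Relation.Unary.Any as Any
open import Data.List.Relation.Unary.Any.Properties using (any⁺; any⁻)
open import Data.Nat using (ℕ; zero; suc; _+_; _∸_; _≤_; _<_; _<?_)
import Data.Nat.Properties as ℕ
open import Data.Nat.Properties using (_≟_)
open import Data.Nat.Combinatorics using (_C_; nCk+nC[k+1]≡[n+1]C[k+1])
open import Data.Product using (∃-syntax; _×_; _,_; proj₁; proj₂)
open import Data.Rational as ℚ using (ℚ; _/_; toℚᵘ)
import Data.Rational.Properties as ℚ
open import Data.Rational.Unnormalised using (mkℚᵘ; *≤*)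
import Data.Rational.Unnormalised.Properties as ℚᵘ
open import Data.Vec using (_∷_; [])
import Data.Vec.Properties as Vec
open import Function using (_∘_)
open import Function.Bundles using (_⇔_; mk⇔; module Equivalence)
open import Relation.Nullary using (¬_; Dec; does; yes; no)
open import Relation.Nullary.Decidable
  using (⌊_⌋; isYes≗does; dec-true; toWitness; decidable-stable)
open import Relation.Binary.PropositionalEquality

⌊⌋-cong : ∀ {A B : Set} (a? : Dec A) (b? : Dec B) → does a? ≡ does b? → ⌊ a? ⌋ ≡ ⌊ b? ⌋
⌊⌋-cong a? b? eq = trans (isYes≗does a?) (trans eq (sym (isYes≗does b?)))

isYes⁺ : ∀ {A : Set} (a? : Dec A) → A → ⌊ a? ⌋ ≡ true
isYes⁺ a? a = trans (isYes≗does a?) (dec-true a? a)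

isYes⁻ : ∀ {A : Set} (a? : Dec A) → ⌊ a? ⌋ ≡ true → A
isYes⁻ a? h = toWitness (Equivalence.from T-≡ h)

∧-intro : ∀ {a b} → a ≡ true → b ≡ true → a ∧ b ≡ true
∧-intro refl refl = refl

∧-elim : ∀ a {b} → a ∧ b ≡ true → a ≡ true × b ≡ true
∧-elim a h = ∧-conicalˡ a _ h , ∧-conicalʳ a _ h

not-intro : ∀ {a} → ¬ a ≡ true → not a ≡ true
not-intro {false} _  = refl
not-intro {true}  ¬t = ⊥-elim (¬t refl)

not-elim : ∀ {a} → not a ≡ true → ¬ a ≡ true
not-elim {false} _ ()

module _ {A : Set} where

  countᵇ : (A → Bool) → List A → ℕ
  countᵇ p xs = length (filter (λ x → p x Bool.≟ true) xs)

  countᵇ-mono : {p q : A → Bool} → (∀ x → p x ≡ true → q x ≡ true) →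
                ∀ xs → countᵇ p xs ≤ countᵇ q xs
  countᵇ-mono p⇒q xs = length-mono-≤ (filter⁺ _ _ (λ { refl → p⇒q _ }) (⊆-refl {x = xs}))

  countᵇ-cong : {p q : A → Bool} → (∀ x → p x ≡ q x) → ∀ xs → countᵇ p xs ≡ countᵇ q xs
  countᵇ-cong p≗q xs = ℕ.≤-antisym (countᵇ-mono (λ x → trans (sym (p≗q x))) xs)
                                   (countᵇ-mono (λ x → trans (p≗q x)) xs)

  countᵇ-false : ∀ xs → countᵇ (λ _ → false) xs ≡ 0
  countᵇ-false []       = refl
  countᵇ-false (_ ∷ xs) = countᵇ-false xs

  countᵇ-∧-not : ∀ (p q : A → Bool) xs →
                 countᵇ p xs ≡ countᵇ (λ x → p x ∧ q x) xs + countᵇ (λ x → p x ∧ not (q x)) xs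
  countᵇ-∧-not p q []       = refl
  countᵇ-∧-not p q (x ∷ xs) with p x | q x
  ... | true  | true  = cong suc (countᵇ-∧-not p q xs)
  ... | true  | false = trans (cong suc (countᵇ-∧-not p q xs)) (sym (ℕ.+-suc _ _))
  ... | false | _     = countᵇ-∧-not p q xs

  countᵇ-++ : ∀ (p : A → Bool) xs ys → countᵇ p (xs ++ ys) ≡ countᵇ p xs + countᵇ p ys
  countᵇ-++ p xs ys =
    trans (cong length (List.filter-++ _ xs ys)) (List.length-++ (filter _ xs))

  countᵇ>0 : ∀ {p : A → Bool} {x xs} → x ∈ xs → p x ≡ true → 0 < countᵇ p xs
  countᵇ>0 x∈xs px = List.filter-some _ (Any.map (λ { refl → px }) x∈xs)

  countᵇ>0⇒∃ : ∀ {p : A → Bool} xs → 0 < countᵇ p xs → ∃[ x ] p x ≡ true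
  countᵇ>0⇒∃ {p} xs _ with filter (λ x → p x Bool.≟ true) xs in eq
  ... | x ∷ _ = x , proj₂ (∈-filter⁻ _ {xs = xs} (subst (x ∈_) (sym eq) (here refl)))

countᵇ-map : ∀ {A B : Set} (p : B → Bool) (f : A → B) xs →
             countᵇ p (map f xs) ≡ countᵇ (p ∘ f) xs
countᵇ-map p f []       = refl
countᵇ-map p f (x ∷ xs) with p (f x)
... | true  = cong suc (countᵇ-map p f xs)
... | false = countᵇ-map p f xs

∈-allSubsets : ∀ {n} (T : Subset n) → T ∈ allSubsets n
∈-allSubsets []                    = here refl
∈-allSubsets {suc n} (outside ∷ T) = ∈-++⁺ˡ (∈-map⁺ (outside ∷_) (∈-allSubsets T))
∈-allSubsets {suc n} (inside ∷ T)  =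
  ∈-++⁺ʳ (map (outside ∷_) (allSubsets n)) (∈-map⁺ (inside ∷_) (∈-allSubsets T))

module _ {n : ℕ} where

  any-allSubsets⁺ : ∀ {p : Subset n → Bool} T → p T ≡ true → any p (allSubsets n) ≡ true
  any-allSubsets⁺ {p} T pT = Equivalence.to T-≡
    (any⁺ p (Any.map (λ { refl → Equivalence.from T-≡ pT }) (∈-allSubsets T)))

  any-allSubsets⁻ : ∀ {p : Subset n → Bool} → any p (allSubsets n) ≡ true → ∃[ T ] p T ≡ true
  any-allSubsets⁻ {p} h
    with T , pT ← satisfied (any⁻ p (allSubsets n) (Equivalence.from T-≡ h)) =
    T , Equivalence.to T-≡ pT

  _∩_ _∖_ : Family n → Family n → Family n
  (F ∩ G) T = F T ∧ G T
  (F ∖ G) T = F T ∧ not (G T)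

  ∩⁺ : ∀ {F G : Family n} T → T ∈F F → T ∈F G → T ∈F (F ∩ G)
  ∩⁺ _ = ∧-intro

  ∩⁻ : ∀ {F G : Family n} T → T ∈F (F ∩ G) → T ∈F F × T ∈F G
  ∩⁻ {F} T = ∧-elim (F T)

  ∖⁺ : ∀ {F G : Family n} T → T ∈F F → ¬ T ∈F G → T ∈F (F ∖ G)
  ∖⁺ _ T∈F T∉G = ∧-intro T∈F (not-intro T∉G)

  ∖⁻ : ∀ {F G : Family n} T → T ∈F (F ∖ G) → T ∈F F × ¬ T ∈F G
  ∖⁻ {F} T h with T∈F , T∉G ← ∧-elim (F T) h = T∈F , not-elim T∉G

  ｛_｝ : Subset n → Family n
  ｛ e ｝ x = ⌊ Vec.≡-dec Bool._≟_ x e ⌋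

  ∈｛｝⁺ : ∀ e → e ∈F ｛ e ｝
  ∈｛｝⁺ e = isYes⁺ (Vec.≡-dec Bool._≟_ e e) refl

  ∈｛｝⁻ : ∀ {e} x → x ∈F ｛ e ｝ → x ≡ e
  ∈｛｝⁻ {e} x = isYes⁻ (Vec.≡-dec Bool._≟_ x e)

  size-mono : ∀ {F G : Family n} → F ⊆E G → size F ≤ size G
  size-mono F⊆G = countᵇ-mono F⊆G (allSubsets n)

  size-cong : ∀ {F G : Family n} → (∀ T → F T ≡ G T) → size F ≡ size G
  size-cong F≗G = countᵇ-cong F≗G (allSubsets n)

  size-≐ : ∀ {F G : Family n} → F ⊆E G → G ⊆E F → size F ≡ size G
  size-≐ F⊆G G⊆F = ℕ.≤-antisym (size-mono F⊆G) (size-mono G⊆F)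

  size-∅ : size (λ (_ : Subset n) → false) ≡ 0
  size-∅ = countᵇ-false (allSubsets n)

  size>0 : ∀ {F : Family n} {T} → T ∈F F → 0 < size F
  size>0 {T = T} = countᵇ>0 (∈-allSubsets T)

  size>0⇒∃ : ∀ {F : Family n} → 0 < size F → ∃[ T ] T ∈F F
  size>0⇒∃ = countᵇ>0⇒∃ (allSubsets n)

  size-∩-∖ : ∀ (F G : Family n) → size F ≡ size (F ∩ G) + size (F ∖ G)
  size-∩-∖ F G = countᵇ-∧-not F G (allSubsets n)

  size-∖ : ∀ {F G : Family n} → G ⊆E F → size F ≡ size G + size (F ∖ G)
  size-∖ {F} {G} G⊆F = trans (size-∩-∖ F G) (cong (_+ size (F ∖ G)) (size-≐ ∩⊆G G⊆∩))
    where
    ∩⊆G : (F ∩ G) ⊆E G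
    ∩⊆G T = proj₂ ∘ ∩⁻ {F = F} {G = G} T
    G⊆∩ : G ⊆E (F ∩ G)
    G⊆∩ T T∈G = ∩⁺ {F = F} {G = G} T (G⊆F T T∈G) T∈G

  size-∖-∸ : ∀ {F G : Family n} → G ⊆E F → size (F ∖ G) ≡ size F ∸ size G
  size-∖-∸ {F} {G} G⊆F =
    sym (trans (cong (_∸ size G) (size-∖ G⊆F)) (ℕ.m+n∸m≡n (size G) (size (F ∖ G))))

  size-∖-ℤ : ∀ {F G : Family n} → G ⊆E F → + size F - + size G ≡ + size (F ∖ G)
  size-∖-ℤ {F} {G} G⊆F = begin
    + size F - + size G  ≡⟨ ℤ.m-n≡m⊖n (size F) (size G) ⟩
    size F ℤ.⊖ size G    ≡⟨ ℤ.⊖-≥ (size-mono G⊆F) ⟩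
    + (size F ∸ size G)  ≡⟨ cong ℤ.+_ (size-∖-∸ G⊆F) ⟨
    + size (F ∖ G)       ∎
    where open ≡-Reasoning

size-suc : ∀ {n} (F : Family (suc n)) →
           size F ≡ size (λ T → F (outside ∷ T)) + size (λ T → F (inside ∷ T))
size-suc {n} F = trans (countᵇ-++ F (map (outside ∷_) (allSubsets n)) _)
  (cong₂ _+_ (countᵇ-map F _ (allSubsets n)) (countᵇ-map F _ (allSubsets n)))

_choose_ : ∀ {n} → Subset n → ℕ → Family n
(e choose m) T = ⌊ ∣ T ∣ ≟ m ⌋ ∧ ⌊ T ⊆? e ⌋

choose-outside : ∀ {n} y (e T : Subset n) m → ((y ∷ e) choose m) (outside ∷ T) ≡ (e choose m) T
choose-outside y e T m = cong (⌊ ∣ T ∣ ≟ m ⌋ ∧_) (⌊⌋-cong _ (T ⊆? e) refl)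

choose-inside : ∀ {n} (e T : Subset n) m →
                ((inside ∷ e) choose suc m) (inside ∷ T) ≡ (e choose m) T
choose-inside e T m = cong₂ _∧_ (⌊⌋-cong _ (∣ T ∣ ≟ m) refl) (⌊⌋-cong _ (T ⊆? e) refl)

nC0≡1 : ∀ n → n C 0 ≡ 1
nC0≡1 zero    = refl
nC0≡1 (suc n) = refl

size-choose : ∀ {n} (e : Subset n) m → size (e choose m) ≡ ∣ e ∣ C m
size-choose []      zero    = refl
size-choose []      (suc m) = refl
size-choose {suc n} (y ∷ e) m = begin
    size ((y ∷ e) choose m)
  ≡⟨ size-suc ((y ∷ e) choose m) ⟩
    size (λ T → ((y ∷ e) choose m) (outside ∷ T)) + size (λ T → ((y ∷ e) choose m) (inside ∷ T))
  ≡⟨ cong₂ _+_ (trans (size-cong λ T → choose-outside y e T m) (size-choose e m)) refl ⟩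
    ∣ e ∣ C m + size (λ T → ((y ∷ e) choose m) (inside ∷ T))
  ≡⟨ pascal y m ⟩
    ∣ y ∷ e ∣ C m
  ∎
  where
  open ≡-Reasoning
  pascal : ∀ y m → ∣ e ∣ C m + size (λ T → ((y ∷ e) choose m) (inside ∷ T)) ≡ ∣ y ∷ e ∣ C m
  pascal outside m =
    trans (cong₂ _+_ refl (trans (size-cong {n} λ T → ∧-zeroʳ _) (size-∅ {n}))) (ℕ.+-identityʳ _)
  pascal inside zero = trans (cong₂ _+_ (nC0≡1 ∣ e ∣) (size-∅ {n})) (sym (nC0≡1 (suc ∣ e ∣)))
  pascal inside (suc m) = begin
      ∣ e ∣ C suc m + size (λ T → ((inside ∷ e) choose suc m) (inside ∷ T))
    ≡⟨ cong₂ _+_ refl (trans (size-cong λ T → choose-inside e T m) (size-choose e m)) ⟩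
      ∣ e ∣ C suc m + ∣ e ∣ C m
    ≡⟨ ℕ.+-comm (∣ e ∣ C suc m) (∣ e ∣ C m) ⟩
      ∣ e ∣ C m + ∣ e ∣ C suc m
    ≡⟨ nCk+nC[k+1]≡[n+1]C[k+1] ∣ e ∣ m ⟩
      suc ∣ e ∣ C suc m
    ∎

module _ {n : ℕ} (m : ℕ) where

  shadow⁺ : ∀ {E : Family n} {e T} → e ∈F E → T ∈F (e choose m) → T ∈F shadow m E
  shadow⁺ {e = e} {T} e∈E T∈eCm with sized , T⊆e ← ∧-elim ⌊ ∣ T ∣ ≟ m ⌋ T∈eCm =
    ∧-intro sized (any-allSubsets⁺ e (∧-intro e∈E T⊆e))

  shadow⁻ : ∀ {E : Family n} {T} → T ∈F shadow m E → ∃[ e ] e ∈F E × T ∈F (e choose m)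
  shadow⁻ {E} {T} T∈∂E with sized , covered ← ∧-elim ⌊ ∣ T ∣ ≟ m ⌋ T∈∂E
    with e , h ← any-allSubsets⁻ covered with e∈E , T⊆e ← ∧-elim (E e) h =
    e , e∈E , ∧-intro sized T⊆e

  shadow-mono : ∀ {G E : Family n} → G ⊆E E → shadow m G ⊆E shadow m E
  shadow-mono {G} {E} G⊆E T T∈∂G with e , e∈G , T∈eCm ← shadow⁻ {G} T∈∂G =
    shadow⁺ {E} (G⊆E e e∈G) T∈eCm

  hits⁺ : ∀ {S : Family n} {e T} → T ∈F (e choose m) → T ∈F S → hits m S e ≡ true
  hits⁺ {T = T} T∈eCm T∈S with sized , T⊆e ← ∧-elim ⌊ ∣ T ∣ ≟ m ⌋ T∈eCm =
    any-allSubsets⁺ T (∧-intro sized (∧-intro T⊆e T∈S))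

  hits⁻ : ∀ {S : Family n} {e} → hits m S e ≡ true → ∃[ T ] T ∈F (e choose m) × T ∈F S
  hits⁻ {e = e} h with T , h′ ← any-allSubsets⁻ h
    with sized , h″ ← ∧-elim ⌊ ∣ T ∣ ≟ m ⌋ h′ with T⊆e , T∈S ← ∧-elim ⌊ T ⊆? e ⌋ h″ =
    T , ∧-intro sized T⊆e , T∈S

  size-shadow-｛｝ : ∀ e → size (shadow m ｛ e ｝) ≡ ∣ e ∣ C m
  size-shadow-｛｝ e = trans (size-≐ ∂｛e｝⊆eCm eCm⊆∂｛e｝) (size-choose e m)
    where
    ∂｛e｝⊆eCm : shadow m ｛ e ｝ ⊆E (e choose m)
    ∂｛e｝⊆eCm T T∈∂ with e′ , e′∈｛e｝ , T∈e′Cm ← shadow⁻ {｛ e ｝} T∈∂ =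
      subst (λ x → T ∈F (x choose m)) (∈｛｝⁻ e′ e′∈｛e｝) T∈e′Cm
    eCm⊆∂｛e｝ : (e choose m) ⊆E shadow m ｛ e ｝
    eCm⊆∂｛e｝ T = shadow⁺ {｛ e ｝} {T = T} (∈｛｝⁺ e)

-- p / suc a is by definition fromℚᵘ (mkℚᵘ p a), so it suffices to cross-multiply in ℚᵘ.
frac-mono : ∀ {p p' d d'} (d>0 : 0 < d) (d'>0 : 0 < d') →
            p ℤ.≤ p' → + 0 ℤ.≤ p' → d' ≤ d → frac p d d>0 ℚ.≤ frac p' d' d'>0
frac-mono {p} {p'} {suc a} {suc b} _ _ p≤p' 0≤p' d'≤d = ℚ.toℚᵘ-cancel-≤ (begin
    toℚᵘ (p / suc a)   ≃⟨ ℚ.toℚᵘ-fromℚᵘ (mkℚᵘ p a) ⟩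
    mkℚᵘ p a           ≤⟨ *≤* cross ⟩
    mkℚᵘ p' b          ≃⟨ ℚ.toℚᵘ-fromℚᵘ (mkℚᵘ p' b) ⟨
    toℚᵘ (p' / suc b)  ∎)
  where
  open ℚᵘ.≤-Reasoning
  cross : p * + suc b ℤ.≤ p' * + suc a
  cross = ℤ.≤-trans (ℤ.*-monoʳ-≤-nonNeg (+ suc b) p≤p')
                    (ℤ.*-monoˡ-≤-nonNeg p' {{ℤ.nonNegative 0≤p'}} (+≤+ d'≤d))

frac-pred-mono : ∀ {a a' d d'} (d>0 : 0 < d) (d'>0 : 0 < d') → a ≤ a' → 0 < a' → d' ≤ d →
                 frac (+ a - + 1) d d>0 ℚ.≤ frac (+ a' - + 1) d' d'>0
frac-pred-mono d>0 d'>0 a≤a' a'>0 =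
  frac-mono d>0 d'>0 (ℤ.+-monoˡ-≤ (ℤ.- + 1) (+≤+ a≤a')) (ℤ.i≤j⇒0≤j-i (+≤+ a'>0))

BoundedBelowBy : (ℚ → Set) → (ℚ → Set) → Set
BoundedBelowBy P Q = ∀ p → P p → ∃[ q ] Q q × q ℚ.≤ p

IsMin-⇔ : ∀ {P Q} → BoundedBelowBy P Q → BoundedBelowBy Q P → ∀ q → IsMin P q ⇔ IsMin Q q
IsMin-⇔ P≥Q Q≥P q = mk⇔ (transfer P≥Q Q≥P) (transfer Q≥P P≥Q)
  where
  transfer : ∀ {P Q} → BoundedBelowBy P Q → BoundedBelowBy Q P → IsMin P q → IsMin Q q
  transfer {Q = Q} P≥Q Q≥P (q∈P , q≤P) with t , t∈Q , t≤q ← P≥Q q q∈P =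
    subst Q (ℚ.≤-antisym t≤q (q≤Q t t∈Q)) t∈Q , q≤Q
    where
    q≤Q : ∀ q' → Q q' → q ℚ.≤ q'
    q≤Q q' q'∈Q with p , p∈P , p≤q' ← Q≥P q' q'∈Q = ℚ.≤-trans (q≤P p p∈P) p≤q'

module _ {r : ℕ} (H : Hypergraph r) (s : ℕ) where

  private
    E : Family (n H)
    E = edges H

    k : ℕ
    k = s ∸ 1

  hitting>0 : ∀ {S} → (∃[ T ] T ∈F S) → S ⊆E shadow k E → 0 < size (E ∩ hits k S)
  hitting>0 {S} (T , T∈S) S⊆∂E with e , e∈E , T∈eCk ← shadow⁻ k {E} (S⊆∂E T T∈S) =
    size>0 {F = E ∩ hits k S} (∩⁺ {F = E} {G = hits k S} e e∈E (hits⁺ k {S} T∈eCk T∈S))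

  GammaSet-boundedBelowBy-SSet : BoundedBelowBy (GammaSet H s) (SSet H s)
  GammaSet-boundedBelowBy-SSet _ (G , G⊆E , (e , e∈G) , ∂G<∂E , refl) =
    _ , (S , S≠∅ , S⊆∂E , rCk≤∂E∖S , |S|>0 , refl) , value≤
    where
    S = shadow k E ∖ shadow k G
    S⁻ : ∀ T → T ∈F S → T ∈F shadow k E × ¬ T ∈F shadow k G
    S⁻ = ∖⁻ {F = shadow k E} {G = shadow k G}
    S⊆∂E : S ⊆E shadow k E
    S⊆∂E T = proj₁ ∘ S⁻ T
    |S|≡ : size S ≡ size (shadow k E) ∸ size (shadow k G)
    |S|≡ = size-∖-∸ (shadow-mono k G⊆E)
    d>0 = ℕ.m<n⇒0<n∸m ∂G<∂E
    |S|>0 : 0 < size S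
    |S|>0 = subst (0 <_) (sym |S|≡) d>0
    S≠∅ = size>0⇒∃ |S|>0
    eCk⊆∂E∖S : (e choose k) ⊆E (shadow k E ∖ S)
    eCk⊆∂E∖S T T∈eCk = ∖⁺ {F = shadow k E} {G = S} T
      (shadow-mono k G⊆E T T∈∂G) (λ T∈S → proj₂ (S⁻ T T∈S) T∈∂G)
      where T∈∂G = shadow⁺ k {G} {T = T} e∈G T∈eCk
    rCk≤∂E∖S : r C k ≤ size (shadow k E ∖ S)
    rCk≤∂E∖S = subst (λ m → m C k ≤ size (shadow k E ∖ S)) (uniform H e (G⊆E e e∈G))
      (subst (_≤ size (shadow k E ∖ S)) (size-choose e k) (size-mono eCk⊆∂E∖S))
    hitting⊆E∖G : (E ∩ hits k S) ⊆E (E ∖ G)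
    hitting⊆E∖G x h with x∈E , x-hits ← ∩⁻ {F = E} {G = hits k S} x h =
      ∖⁺ {F = E} {G = G} x x∈E λ x∈G → let T , T∈xCk , T∈S = hits⁻ k {S} x-hits in
        proj₂ (S⁻ T T∈S) (shadow⁺ k {G} {T = T} x∈G T∈xCk)
    h = size (E ∩ hits k S)
    value≤ : frac (+ h - + 1) (size S) |S|>0
             ℚ.≤ frac (+ size E - + size G - + 1) (size (shadow k E) ∸ size (shadow k G)) d>0
    value≤ = subst (λ z → frac (+ h - + 1) (size S) |S|>0 ℚ.≤ frac (z - + 1) _ d>0)
      (sym (size-∖-ℤ G⊆E))
      (frac-pred-mono |S|>0 d>0 (size-mono hitting⊆E∖G)
        (ℕ.<-≤-trans (hitting>0 S≠∅ S⊆∂E) (size-mono hitting⊆E∖G)) (ℕ.≤-reflexive (sym |S|≡)))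

  GammaSet-below-SSetValue :
    ∀ {S} → (∃[ T ] T ∈F S) → S ⊆E shadow k E → (|S|>0 : 0 < size S) →
    ∀ G → G ⊆E E → (∃[ e ] e ∈F G) → size (shadow k G) ≤ size (shadow k E ∖ S) →
    (E ∖ G) ⊆E (E ∩ hits k S) →
    ∃[ q ] GammaSet H s q × q ℚ.≤ frac (+ size (E ∩ hits k S) - + 1) (size S) |S|>0
  GammaSet-below-SSetValue {S} S≠∅ S⊆∂E |S|>0 G G⊆E G≠∅ ∂G≤∂E∖S E∖G⊆hitting =
    _ , (G , G⊆E , G≠∅ , ∂G<∂E , refl) , value≤
    where
    |∂E|≡ : size (shadow k E) ≡ size S + size (shadow k E ∖ S)
    |∂E|≡ = size-∖ S⊆∂E
    ∂G<∂E : size (shadow k G) < size (shadow k E)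
    ∂G<∂E = subst (size (shadow k G) <_) (sym |∂E|≡)
      (ℕ.≤-<-trans ∂G≤∂E∖S (ℕ.m<n+m _ |S|>0))
    |S|≤ : size S ≤ size (shadow k E) ∸ size (shadow k G)
    |S|≤ = subst (_≤ size (shadow k E) ∸ size (shadow k G))
      (trans (cong (_∸ size (shadow k E ∖ S)) |∂E|≡)
             (ℕ.m+n∸n≡m (size S) (size (shadow k E ∖ S))))
      (ℕ.∸-monoʳ-≤ (size (shadow k E)) ∂G≤∂E∖S)
    d>0 = ℕ.m<n⇒0<n∸m ∂G<∂E
    h = size (E ∩ hits k S)
    value≤ : frac (+ size E - + size G - + 1) (size (shadow k E) ∸ size (shadow k G)) d>0
             ℚ.≤ frac (+ h - + 1) (size S) |S|>0
    value≤ = subst (λ z → frac (z - + 1) _ d>0 ℚ.≤ frac (+ h - + 1) (size S) |S|>0)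
      (sym (size-∖-ℤ G⊆E))
      (frac-pred-mono d>0 |S|>0 (size-mono E∖G⊆hitting) (hitting>0 S≠∅ S⊆∂E) |S|≤)

  SSet-boundedBelowBy-GammaSet : (∃[ e ] e ∈F E) → BoundedBelowBy (SSet H s) (GammaSet H s)
  SSet-boundedBelowBy-GammaSet (e₀ , e₀∈E) _ (S , S≠∅ , S⊆∂E , rCk≤∂E∖S , |S|>0 , refl)
    with 0 <? size (E ∖ hits k S)
  ... | yes missing>0 =
    GammaSet-below-SSetValue S≠∅ S⊆∂E |S|>0 G (λ x → proj₁ ∘ G⁻ x)
      (size>0⇒∃ missing>0) (size-mono ∂G⊆∂E∖S) E∖G⊆hitting
    where
    G = E ∖ hits k S
    G⁻ : ∀ x → x ∈F G → x ∈F E × ¬ hits k S x ≡ true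
    G⁻ = ∖⁻ {F = E} {G = hits k S}
    ∂G⊆∂E∖S : shadow k G ⊆E (shadow k E ∖ S)
    ∂G⊆∂E∖S T T∈∂G with e , e∈G , T∈eCk ← shadow⁻ k {G} T∈∂G with e∈E , e-misses ← G⁻ e e∈G =
      ∖⁺ {F = shadow k E} {G = S} T (shadow⁺ k {E} {T = T} e∈E T∈eCk) λ T∈S →
        e-misses (hits⁺ k {S} T∈eCk T∈S)
    E∖G⊆hitting : (E ∖ G) ⊆E (E ∩ hits k S)
    E∖G⊆hitting x h with x∈E , x∉G ← ∖⁻ {F = E} {G = G} x h =
      ∩⁺ {F = E} {G = hits k S} x x∈E (decidable-stable (hits k S x Bool.≟ true) λ x-misses →
        x∉G (∖⁺ {F = E} {G = hits k S} x x∈E x-misses))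
  ... | no ¬missing>0 =
    GammaSet-below-SSetValue S≠∅ S⊆∂E |S|>0 ｛ e₀ ｝ ｛e₀｝⊆E (e₀ , ∈｛｝⁺ e₀)
      ∂｛e₀｝≤∂E∖S E∖｛e₀｝⊆hitting
    where
    ｛e₀｝⊆E : ｛ e₀ ｝ ⊆E E
    ｛e₀｝⊆E x x∈｛e₀｝ = subst (_∈F E) (sym (∈｛｝⁻ x x∈｛e₀｝)) e₀∈E
    ∂｛e₀｝≤∂E∖S : size (shadow k ｛ e₀ ｝) ≤ size (shadow k E ∖ S)
    ∂｛e₀｝≤∂E∖S = subst (_≤ size (shadow k E ∖ S))
      (sym (trans (size-shadow-｛｝ k e₀) (cong (_C k) (uniform H e₀ e₀∈E)))) rCk≤∂E∖S
    E∖｛e₀｝⊆hitting : (E ∖ ｛ e₀ ｝) ⊆E (E ∩ hits k S)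
    E∖｛e₀｝⊆hitting x h with x∈E , _ ← ∖⁻ {F = E} {G = ｛ e₀ ｝} x h =
      ∩⁺ {F = E} {G = hits k S} x x∈E (decidable-stable (hits k S x Bool.≟ true) λ x-misses →
        ¬missing>0 (size>0 {F = E ∖ hits k S} (∖⁺ {F = E} {G = hits k S} x x∈E x-misses)))

proposition5p3 : (r s : ℕ) → 2 ≤ r → 2 ≤ s → (H : Hypergraph r) → HasSparseness H s →
    (q : ℚ) → IsMin (GammaSet H s) q ⇔ IsMin (SSet H s) q
proposition5p3 r s _ _ H (H≠∅ , _) =
  IsMin-⇔ (GammaSet-boundedBelowBy-SSet H s) (SSet-boundedBelowBy-GammaSet H s H≠∅)
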